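{- Let $n\geq1$ and $S,T\subseteq[n-1]$, and let $$A(q)_{ST}=\sum_{\substack{w\in\mathfrak{S}_n\\ \overline{S}\subseteq C(w),\ T\subseteq D(w)}} q^{\mathrm{inv}(w)}.$$ Then $A(q)_{ST}=q^{z(T)}\,\eta(\overline{S},q)/\eta(\overline{T},q)$ if $\overline{S}\cap T=\emptyset$, and $A(q)_{ST}=0$ otherwise.
   Context: $[n]=\{1,\dots,n\}$, $\mathfrak{S}_n$ is the set of permutations $w=a_1\cdots a_n$ of $[n]$; $\mathrm{inv}(w)=\#\{(i,j): i<j,\ a_i>a_j\}$. For $X\subseteq[n-1]$, $\overline{X}=[n-1]\setminus X$. $D(w)=\{i : a_i>a_{i+1}\}$ and $C(w)=\{i\in[n-1] : a_j<a_k \text{ for all } j\leq i<k\}$. Let $(j)=1+q+\cdots+q^{j-1}$ and $(j)!=(1)(2)\cdots(j)$. For $X=\{i_1<\cdots<i_k\}\subseteq[n-1]$, $\eta(X,q)=(i_1)!\,(i_2-i_1)!\cdots(i_k-i_{k-1})!\,(n-i_k)!$ (the $q$-factorials). For $T\subseteq[n-1]$ with $\overline{T}=\{i_1<\cdots<i_k\}$, $z(T)=\binom{i_1}{2}+\binom{i_2-i_1}{2}+\cdots+\binom{n-i_k}{2}$. -}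

module Defs where

open import Data.Nat using (ℕ; zero; suc; _+_; _*_; _^_; _≤_; _<_)
open import Data.Nat.Combinatorics using (_C_)
open import Data.Bool using (Bool; true; false; if_then_else_)
open import Data.List using (List; []; _∷_; map; concatMap)
open import Data.Nat.ListAction using (sum; product)
open import Data.Vec using (Vec; []; _∷_; lookup; toList)
open import Data.Fin using (Fin; toℕ; inject₁) renaming (_<_ to _<ᶠ_; _≤_ to _≤ᶠ_)
open import Data.Fin.Properties using (all?; _≟_) renaming (_<?_ to _<ᶠ?_; _≤?_ to _≤ᶠ?_)
open import Data.Fin.Subset using (Subset; _∈_; _∉_; ∁)
open import Data.Fin.Subset.Properties using (_∈?_)
open import Relation.Nullary using (Dec; ¬_; ¬?)
open import Relation.Nullary.Decidable using (⌊_⌋; _→-dec_)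
open import Relation.Binary.PropositionalEquality using (_≡_)

allWords : (n m : ℕ) → List (Vec (Fin n) m)
allWords n zero    = [] ∷ []
allWords n (suc m) = concatMap (λ a → map (a ∷_) (allWords n m)) (allFin n)
  where open import Data.List using (allFin)

IsPerm : {n : ℕ} → Vec (Fin n) n → Set
IsPerm {n} w = ∀ (i j : Fin n) → lookup w i ≡ lookup w j → i ≡ j

isPerm? : {n : ℕ} → (w : Vec (Fin n) n) → Dec (IsPerm w)
isPerm? w = all? λ i → all? λ j → (lookup w i ≟ lookup w j) →-dec (i ≟ j)

inv : {n : ℕ} → Vec (Fin n) n → ℕ
inv {n} w = sum (map (λ i → sum (map (λ j →
  if ⌊ i <ᶠ? j ⌋ then (if ⌊ lookup w j <ᶠ? lookup w i ⌋ then 1 else 0) else 0)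
  (Data.List.allFin n))) (Data.List.allFin n))
  where import Data.List

-- Permutations of [n] with n = suc k; an element j : Fin k of a Subset k stands for
-- the element i = toℕ j + 1 of [n-1] = [k].  Positions are 0-indexed in the Vec,
-- so a_i = lookup w (inject₁ j) and a_{i+1} = lookup w (suc j).

InDes : {k : ℕ} → Vec (Fin (suc k)) (suc k) → Fin k → Set
InDes w j = lookup w (Fin.suc j) <ᶠ lookup w (inject₁ j)
  where import Data.Fin as Fin

-- i ∈ C(w) : a_p < a_r for all p ≤ i < r   (1-indexed p, r)
InC : {k : ℕ} → Vec (Fin (suc k)) (suc k) → Fin k → Set
InC {k} w j = ∀ (p r : Fin (suc k)) → toℕ p ≤ toℕ j → toℕ j < toℕ r → lookup w p <ᶠ lookup w r

inDes? : {k : ℕ} → (w : Vec (Fin (suc k)) (suc k)) → (j : Fin k) → Dec (InDes w j)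
inDes? w j = lookup w (Data.Fin.suc j) <ᶠ? lookup w (inject₁ j)
  where import Data.Fin

inC? : {k : ℕ} → (w : Vec (Fin (suc k)) (suc k)) → (j : Fin k) → Dec (InC w j)
inC? w j = all? λ p → all? λ r →
  (toℕ p Data.Nat.≤? toℕ j) →-dec ((toℕ j Data.Nat.<? toℕ r) →-dec (lookup w p <ᶠ? lookup w r))
  where import Data.Nat

Admissible : {k : ℕ} → Subset k → Subset k → Vec (Fin (suc k)) (suc k) → Set
Admissible S T w = (∀ j → j ∈ ∁ S → InC w j) × (∀ j → j ∈ T → InDes w j)
  where open import Data.Product using (_×_)

admissible? : {k : ℕ} → (S T : Subset k) → (w : Vec (Fin (suc k)) (suc k)) → Dec (Admissible S T w)
admissible? S T w = (all? λ j → (j ∈? ∁ S) →-dec inC? w j) ×-dec (all? λ j → (j ∈? T) →-dec inDes? w j)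
  where open import Relation.Nullary.Decidable using (_×-dec_)

A : (k : ℕ) → Subset k → Subset k → ℕ → ℕ
A k S T q = sum (map (λ w → if ⌊ isPerm? w ⌋ then (if ⌊ admissible? S T w ⌋ then q ^ inv w else 0) else 0)
                     (allWords (suc k) (suc k)))

qint : ℕ → ℕ → ℕ
qint zero    q = 0
qint (suc j) q = qint j q + q ^ j

qfact : ℕ → ℕ → ℕ
qfact zero    q = 1
qfact (suc j) q = qfact j q * qint (suc j) q

-- Block lengths of X = {i_1 < ⋯ < i_m} ⊆ [n-1] (n = suc k):
-- i_1, i_2 - i_1, …, n - i_m.  Given the membership bits of 1, …, k.
blocksAux : ℕ → List Bool → List ℕ
blocksAux c []            = c ∷ []
blocksAux c (true  ∷ bs)  = c ∷ blocksAux 1 bs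
blocksAux c (false ∷ bs)  = blocksAux (suc c) bs

blocks : {k : ℕ} → Subset k → List ℕ
blocks X = blocksAux 1 (toList X)

η : {k : ℕ} → Subset k → ℕ → ℕ
η X q = product (map (λ b → qfact b q) (blocks X))

z : {k : ℕ} → Subset k → ℕ
z T = sum (map (λ b → b C 2) (blocks (∁ T)))

{-# OPTIONS --safe #-}
-- Read w = a₀ ⋯ a_k from left to right and weight each letter by q to the power of its rank among
-- the values not used before it; these ranks add up to inv(w).  For a permutation, S̄ ⊆ C(w) says
-- (by pigeonhole) that every letter is at most the first cut of S̄ at or after its position
-- (counting from 0), and T ⊆ D(w) that a letter following a cut of T is smaller than its
-- predecessor.  All values beyond the current S̄-block are still unused, so both conditions become
-- bounds on ranks alone: a rank is less than the number of positions left in its S̄-block, or,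
-- after a cut of T, less than the previous rank.  Hence A(q)_{ST} is a sum over bounded rank
-- sequences.  When S̄ ∩ T = ∅ every block of T̄ lies inside a block of S̄ and carries a strictly
-- decreasing run of ranks, which contributes q^binom(r,2) times a q-binomial coefficient; the
-- product of these telescopes to q^z(T) η(S̄) / η(T̄).  When i ∈ S̄ ∩ T, C(w) and D(w) would need
-- both a_i < a_{i+1} and a_i > a_{i+1}, so nothing is counted.
module Submission where

open import Defs
open import Data.Nat
  using (ℕ; zero; suc; _+_; _*_; _^_; _∸_; _≤_; _<_; z≤n; s≤s; s≤s⁻¹; _≤′_; ≤′-reflexive; ≤′-step)
open import Data.Nat.Properties
open import Algebra.Properties.CommutativeSemigroup +-commutativeSemigroup using (xy∙z≈xz∙y)
open import Data.Nat.Combinatorics using (_C_; nC1≡n; nCk+nC[k+1]≡[n+1]C[k+1])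
open import Data.Nat.ListAction using (sum; product)
open import Data.Nat.ListAction.Properties using (sum-++)
open import Data.Nat.Tactic.RingSolver using (solve-∀)
open import Data.Bool using (Bool; true; false; if_then_else_; not; _∧_; T)
open import Data.Bool.Properties using (∧-identityʳ; T-∧)
open import Data.List using (List; []; _∷_; _++_; map; concatMap; allFin; tabulate)
open import Data.List.Properties using (map-tabulate; map-++; map-∘; map-cong)
open import Data.Vec using (Vec; []; _∷_; toList; lookup; count; here; there)
open import Data.Fin using (Fin; toℕ; fromℕ<; inject₁) renaming (zero to fzero; suc to fsuc)
open import Data.Fin.Properties using (toℕ-fromℕ<; toℕ<n; toℕ-injective; toℕ-inject₁; injective⇒≤)
  renaming (_<?_ to _<ᶠ?_; suc-injective to fsuc-injective)
open import Data.Fin.Subset using (Subset; inside; outside; _∈_; _⊆_; ∁; _∩_; Empty)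
open import Data.Fin.Subset.Properties using (drop-∷-⊆; x∉p⇒x∈∁p; x∈p∩q⁺; x∈p∩q⁻)
open import Data.Product using (_×_; _,_; proj₁; proj₂; ∃-syntax)
open import Data.Sum as Sum using (_⊎_; inj₁; inj₂)
open import Data.Unit using (⊤; tt)
open import Data.Maybe using (Maybe; just; nothing; fromMaybe)
open import Data.Maybe.Relation.Unary.All using (just; nothing) renaming (All to AllMaybe)
open import Function using (_∘_; const; _⇔_; mk⇔; Equivalence)
open import Relation.Nullary using (¬_; Dec; does; yes; no; contradiction)
open import Relation.Nullary.Decidable using (⌊_⌋; isYes≗does; dec-true; dec-false; does-⇔; T?; _×-dec_; decidable-stable)
open import Relation.Binary.PropositionalEquality using (_≡_; _≢_; refl; sym; trans; cong; cong₂; subst; module ≡-Reasoning)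
open ≡-Reasoning

when : Bool → ℕ → ℕ
when b x = if b then x else 0

when-T : ∀ {b} x → T b → when b x ≡ x
when-T {true} x _ = refl

when-∧ : ∀ a b x → when (a ∧ b) x ≡ when b (when a x)
when-∧ true  b     x = refl
when-∧ false true  x = refl
when-∧ false false x = refl

when-dec-cong : ∀ {A : Set} {x y} (a? : Dec A) → (A → x ≡ y) → when (does a?) x ≡ when (does a?) y
when-dec-cong (yes a) x≡y = x≡y a
when-dec-cong (no _)  _   = refl

when-dec-zero : ∀ {A : Set} {x} (a? : Dec A) → (A → x ≡ 0) → when (does a?) x ≡ 0
when-dec-zero (yes a) x≡0 = x≡0 a
when-dec-zero (no _)  _   = refl

sumBelow : ℕ → (ℕ → ℕ) → ℕ
sumBelow zero    f = 0
sumBelow (suc c) f = sumBelow c f + f c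

sumBelow-cong : ∀ c {f g : ℕ → ℕ} → (∀ i → i < c → f i ≡ g i) → sumBelow c f ≡ sumBelow c g
sumBelow-cong zero    f≡g = refl
sumBelow-cong (suc c) f≡g =
  cong₂ _+_ (sumBelow-cong c (λ i i<c → f≡g i (m<n⇒m<1+n i<c))) (f≡g c (n<1+n c))

sumBelow-*ʳ : ∀ c (f : ℕ → ℕ) x → sumBelow c (λ i → f i * x) ≡ sumBelow c f * x
sumBelow-*ʳ zero    f x = refl
sumBelow-*ʳ (suc c) f x = begin
  sumBelow c (λ i → f i * x) + f c * x ≡⟨ cong (_+ f c * x) (sumBelow-*ʳ c f x) ⟩
  sumBelow c f * x + f c * x           ≡⟨ *-distribʳ-+ x (sumBelow c f) (f c) ⟨
  (sumBelow c f + f c) * x             ∎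

sumBelow-suc : ∀ c (f : ℕ → ℕ) → sumBelow (suc c) f ≡ f 0 + sumBelow c (f ∘ suc)
sumBelow-suc zero    f = +-comm 0 (f 0)
sumBelow-suc (suc c) f = begin
  sumBelow (suc c) f + f (suc c)         ≡⟨ cong (_+ f (suc c)) (sumBelow-suc c f) ⟩
  f 0 + sumBelow c (f ∘ suc) + f (suc c) ≡⟨ +-assoc (f 0) _ _ ⟩
  f 0 + sumBelow (suc c) (f ∘ suc)       ∎

sumBelow-restrict : ∀ {B N} (g : ℕ → ℕ) → B ≤ N → sumBelow N (λ v → when (does (v <? B)) (g v)) ≡ sumBelow B g
sumBelow-restrict {B} g B≤N = go (≤⇒≤′ B≤N)
  where
  go : ∀ {N} → B ≤′ N → sumBelow N (λ v → when (does (v <? B)) (g v)) ≡ sumBelow B g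
  go (≤′-reflexive refl) = sumBelow-cong B (λ v v<B → cong (λ b → when b (g v)) (dec-true (v <? B) v<B))
  go (≤′-step {N} B≤′N)  = begin
    sumBelow N (λ v → when (does (v <? B)) (g v)) + when (does (N <? B)) (g N)
      ≡⟨ cong₂ _+_ (go B≤′N) (cong (λ b → when b (g N)) (dec-false (N <? B) (≤⇒≯ (≤′⇒≤ B≤′N)))) ⟩
    sumBelow B g + 0 ≡⟨ +-identityʳ _ ⟩
    sumBelow B g     ∎

sum-map-allFin : ∀ N (f : ℕ → ℕ) → sum (map (f ∘ toℕ) (allFin N)) ≡ sumBelow N f
sum-map-allFin N f = trans (cong sum (map-tabulate {n = N} (λ i → i) (f ∘ toℕ))) (sum-tabulate N f)
  where
  sum-tabulate : ∀ N (f : ℕ → ℕ) → sum (tabulate {n = N} (f ∘ toℕ)) ≡ sumBelow N f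
  sum-tabulate zero    f = refl
  sum-tabulate (suc N) f = trans (cong (f 0 +_) (sum-tabulate N (f ∘ suc))) (sym (sumBelow-suc N f))

sum-allFin-suc : ∀ m (f : Fin (suc m) → ℕ) → sum (map f (allFin (suc m))) ≡ f fzero + sum (map (f ∘ fsuc) (allFin m))
sum-allFin-suc m f = cong (λ xs → f fzero + sum xs)
  (trans (map-tabulate {n = m} fsuc f) (sym (map-tabulate {n = m} (λ i → i) (f ∘ fsuc))))

sum-map-zero : ∀ {A : Set} (f : A → ℕ) xs → (∀ x → f x ≡ 0) → sum (map f xs) ≡ 0
sum-map-zero f []       f≡0 = refl
sum-map-zero f (x ∷ xs) f≡0 = cong₂ _+_ (f≡0 x) (sum-map-zero f xs f≡0)

sum-map-*ˡ : ∀ {A : Set} c (f : A → ℕ) xs → sum (map (λ x → c * f x) xs) ≡ c * sum (map f xs)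
sum-map-*ˡ c f []       = sym (*-zeroʳ c)
sum-map-*ˡ c f (x ∷ xs) = trans (cong (c * f x +_) (sum-map-*ˡ c f xs)) (sym (*-distribˡ-+ c (f x) _))

sum-map-when : ∀ {A : Set} b (f : A → ℕ) xs → sum (map (λ x → when b (f x)) xs) ≡ when b (sum (map f xs))
sum-map-when true  f xs       = refl
sum-map-when false f []       = refl
sum-map-when false f (x ∷ xs) = sum-map-when false f xs

sum-map-concatMap : ∀ {A B : Set} (f : B → ℕ) (g : A → List B) xs →
  sum (map f (concatMap g xs)) ≡ sum (map (λ x → sum (map f (g x))) xs)
sum-map-concatMap f g []       = refl
sum-map-concatMap f g (x ∷ xs) = begin
  sum (map f (g x ++ concatMap g xs))                   ≡⟨ cong sum (map-++ f (g x) (concatMap g xs)) ⟩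
  sum (map f (g x) ++ map f (concatMap g xs))           ≡⟨ sum-++ (map f (g x)) (map f (concatMap g xs)) ⟩
  sum (map f (g x)) + sum (map f (concatMap g xs))      ≡⟨ cong (sum (map f (g x)) +_) (sum-map-concatMap f g xs) ⟩
  sum (map f (g x)) + sum (map (λ x → sum (map f (g x))) xs) ∎

firstBlock : ∀ {m} → Subset m → ℕ
firstBlock []            = 1
firstBlock (inside ∷ X)  = 1
firstBlock (outside ∷ X) = suc (firstBlock X)

tailBlocks : ∀ {m} → Subset m → List ℕ
tailBlocks []            = []
tailBlocks (inside ∷ X)  = blocks X
tailBlocks (outside ∷ X) = tailBlocks X

blocksAux-split : ∀ {m} c (X : Subset m) → blocksAux (suc c) (toList X) ≡ c + firstBlock X ∷ tailBlocks X
blocksAux-split c []            = cong (_∷ []) (sym (+-comm c 1))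
blocksAux-split c (inside ∷ X)  = cong (_∷ blocks X) (sym (+-comm c 1))
blocksAux-split c (outside ∷ X) =
  trans (blocksAux-split (suc c) X) (cong (_∷ tailBlocks X) (sym (+-suc c (firstBlock X))))

blocks-split : ∀ {m} (X : Subset m) → blocks X ≡ firstBlock X ∷ tailBlocks X
blocks-split = blocksAux-split 0

firstBlock≤1+m : ∀ {m} (X : Subset m) → firstBlock X ≤ suc m
firstBlock≤1+m []            = ≤-refl
firstBlock≤1+m (inside ∷ X)  = s≤s z≤n
firstBlock≤1+m (outside ∷ X) = s≤s (firstBlock≤1+m X)

firstBlock-∷ : ∀ {m} x (X : Subset m) → firstBlock (x ∷ X) ≤ suc (firstBlock X)
firstBlock-∷ inside  X = s≤s z≤n
firstBlock-∷ outside X = ≤-refl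

firstBlock-∈ : ∀ {m} {X : Subset m} {j} → j ∈ X → firstBlock X ≤ suc (toℕ j)
firstBlock-∈ {X = inside ∷ X} here       = ≤-refl
firstBlock-∈ {X = x ∷ X}      (there j∈) = ≤-trans (firstBlock-∷ x X) (s≤s (firstBlock-∈ j∈))

firstBlock-attained : ∀ {m} (X : Subset m) → (∃[ j ] j ∈ X × firstBlock X ≡ suc (toℕ j)) ⊎ firstBlock X ≡ suc m
firstBlock-attained []            = inj₂ refl
firstBlock-attained (inside ∷ X)  = inj₁ (fzero , here , refl)
firstBlock-attained (outside ∷ X) =
  Sum.map (λ (j , j∈ , e) → fsuc j , there j∈ , cong suc e) (cong suc) (firstBlock-attained X)

below-firstBlock : ∀ {m t v} (X : Subset m) → (∀ j → j ∈ X → v ≤ t + toℕ j) → v < t + suc m → v < t + firstBlock X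
below-firstBlock {t = t} {v} X bounded v<t+1+m with firstBlock-attained X
... | inj₁ (j , j∈ , e) = subst (λ b → v < t + b) (sym e) (subst (v <_) (sym (+-suc t (toℕ j))) (s≤s (bounded j j∈)))
... | inj₂ e            = subst (λ b → v < t + b) (sym e) v<t+1+m

firstBlock-⊆ : ∀ {m} {X Y : Subset m} → X ⊆ Y → firstBlock Y ≤ firstBlock X
firstBlock-⊆ {X = []}          {[]}          _   = ≤-refl
firstBlock-⊆ {X = inside ∷ X}  {y ∷ Y}       X⊆Y with X⊆Y here
... | here = ≤-refl
firstBlock-⊆ {X = outside ∷ X} {inside ∷ Y}  _   = s≤s z≤n
firstBlock-⊆ {X = outside ∷ X} {outside ∷ Y} X⊆Y = s≤s (firstBlock-⊆ (drop-∷-⊆ X⊆Y))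

[1+m]C2≡m+mC2 : ∀ m → suc m C 2 ≡ m + m C 2
[1+m]C2≡m+mC2 m = trans (sym (nCk+nC[k+1]≡[n+1]C[k+1] m 1)) (cong (_+ m C 2) (nC1≡n m))

module QCalculus (q : ℕ) where

  [_] : ℕ → ℕ
  [ j ] = qint j q

  [_]! : ℕ → ℕ
  [ j ]! = qfact j q

  qint-+ : ∀ a b → [ a + b ] ≡ [ a ] + q ^ a * [ b ]
  qint-+ a zero    = trans (cong [_] (+-identityʳ a)) (sym (trans (cong ([ a ] +_) (*-zeroʳ (q ^ a))) (+-identityʳ _)))
  qint-+ a (suc b) = begin
    [ a + suc b ]                              ≡⟨ cong [_] (+-suc a b) ⟩
    [ a + b ] + q ^ (a + b)                    ≡⟨ cong₂ _+_ (qint-+ a b) (^-distribˡ-+-* q a b) ⟩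
    [ a ] + q ^ a * [ b ] + q ^ a * q ^ b      ≡⟨ regroup [ a ] (q ^ a) [ b ] (q ^ b) ⟩
    [ a ] + q ^ a * [ suc b ]                  ∎
    where
    regroup : ∀ x y z w → x + y * z + y * w ≡ x + y * (z + w)
    regroup = solve-∀

  descendingSum : ℕ → ℕ → ℕ
  descendingSum c zero    = 1
  descendingSum c (suc m) = sumBelow c (λ i → q ^ i * descendingSum i m)

  descendingSum≡0 : ∀ {c m} → c < m → descendingSum c m ≡ 0
  descendingSum≡0 {zero}  {suc m} _ = refl
  descendingSum≡0 {suc c} {suc m} (s≤s c<m)
    rewrite descendingSum≡0 (m<n⇒m<1+n c<m) | descendingSum≡0 c<m | *-zeroʳ (q ^ c) = refl

  descendingSum-diag : ∀ m → descendingSum m m ≡ q ^ (m C 2)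
  descendingSum-diag zero    = refl
  descendingSum-diag (suc m) = begin
    descendingSum m (suc m) + q ^ m * descendingSum m m
      ≡⟨ cong₂ (λ u v → u + q ^ m * v) (descendingSum≡0 (n<1+n m)) (descendingSum-diag m) ⟩
    q ^ m * q ^ (m C 2)                                 ≡⟨ ^-distribˡ-+-* q m (m C 2) ⟨
    q ^ (m + m C 2)                                     ≡⟨ cong (q ^_) ([1+m]C2≡m+mC2 m) ⟨
    q ^ (suc m C 2)                                     ∎

  -- Stated for c = d + m so that the Pascal recursion below is structural in m and d.
  descendingSum-qbinomial : ∀ m d → descendingSum (d + m) m * [ m ]! * [ d ]! ≡ q ^ (m C 2) * [ d + m ]!
  descendingSum-qbinomial m       zero    = begin
    descendingSum m m * [ m ]! * 1 ≡⟨ *-identityʳ _ ⟩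
    descendingSum m m * [ m ]!     ≡⟨ cong (_* [ m ]!) (descendingSum-diag m) ⟩
    q ^ (m C 2) * [ m ]!           ∎
  descendingSum-qbinomial zero    (suc d) =
    trans (*-identityˡ [ suc d ]!) (sym (trans (*-identityˡ _) (cong [_]! (+-identityʳ (suc d)))))
  descendingSum-qbinomial (suc m) (suc d) = begin
    (X + q ^ c * Y) * ([ m ]! * [ suc m ]) * ([ d ]! * [ suc d ])
      ≡⟨ expand X (q ^ c) Y [ m ]! [ suc m ] [ d ]! [ suc d ] ⟩
    X * ([ m ]! * [ suc m ]) * [ d ]! * [ suc d ] + q ^ c * [ suc m ] * (Y * [ m ]! * ([ d ]! * [ suc d ]))
      ≡⟨ cong₂ (λ u v → u * [ suc d ] + q ^ c * [ suc m ] * v) (descendingSum-qbinomial (suc m) d) IH ⟩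
    q ^ (suc m C 2) * [ c ]! * [ suc d ] + q ^ c * [ suc m ] * (q ^ (m C 2) * [ c ]!)
      ≡⟨ cong₂ (λ u v → q ^ u * [ c ]! * [ suc d ] + v * [ suc m ] * (q ^ (m C 2) * [ c ]!))
               ([1+m]C2≡m+mC2 m) (trans (cong (q ^_) (+-comm d (suc m))) (^-distribˡ-+-* q (suc m) d)) ⟩
    q ^ (m + m C 2) * [ c ]! * [ suc d ] + q * q ^ m * q ^ d * [ suc m ] * (q ^ (m C 2) * [ c ]!)
      ≡⟨ cong (λ u → u * [ c ]! * [ suc d ] + q * q ^ m * q ^ d * [ suc m ] * (q ^ (m C 2) * [ c ]!))
              (^-distribˡ-+-* q m (m C 2)) ⟩
    q ^ m * q ^ (m C 2) * [ c ]! * [ suc d ] + q * q ^ m * q ^ d * [ suc m ] * (q ^ (m C 2) * [ c ]!)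
      ≡⟨ collect (q ^ m) (q ^ (m C 2)) [ c ]! [ suc d ] q (q ^ d) [ suc m ] ⟩
    q ^ m * q ^ (m C 2) * ([ c ]! * ([ suc d ] + q * q ^ d * [ suc m ]))
      ≡⟨ cong₂ (λ u v → u * ([ c ]! * v)) (^-distribˡ-+-* q m (m C 2)) (qint-+ (suc d) (suc m)) ⟨
    q ^ (m + m C 2) * [ suc d + suc m ]!
      ≡⟨ cong (λ u → q ^ u * [ suc d + suc m ]!) ([1+m]C2≡m+mC2 m) ⟨
    q ^ (suc m C 2) * [ suc d + suc m ]!
      ∎
    where
    c = d + suc m
    X = descendingSum c (suc m)
    Y = descendingSum c m
    IH : Y * [ m ]! * ([ d ]! * [ suc d ]) ≡ q ^ (m C 2) * [ c ]!
    IH = subst (λ e → descendingSum e m * [ m ]! * [ suc d ]! ≡ q ^ (m C 2) * [ e ]!)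
               (sym (+-suc d m)) (descendingSum-qbinomial m (suc d))
    expand : ∀ x y z f i g j → (x + y * z) * (f * i) * (g * j) ≡ x * (f * i) * g * j + y * i * (z * f * (g * j))
    expand = solve-∀
    collect : ∀ a b f j q′ e i → a * b * f * j + q′ * a * e * i * (b * f) ≡ a * b * (f * (j + q′ * e * i))
    collect = solve-∀

  descendingSum-qbinomial′ : ∀ {c m} → m ≤ c → descendingSum c m * [ m ]! * [ c ∸ m ]! ≡ q ^ (m C 2) * [ c ]!
  descendingSum-qbinomial′ {c} {m} m≤c =
    subst (λ e → descendingSum e m * [ m ]! * [ c ∸ m ]! ≡ q ^ (m C 2) * [ e ]!)
          (m∸n+n≡m m≤c) (descendingSum-qbinomial m (c ∸ m))

  -- Rank sequences with i₀ < c: after a cut outside Y the next rank is below the current one,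
  -- after a cut in Y it is below the number of positions left in the current block of X.
  mutual
    chainSum : ∀ {m} → Subset m → Subset m → ℕ → ℕ
    chainSum X Y c = sumBelow c (λ i → q ^ i * chainSumFrom X Y i)

    chainSumFrom : ∀ {m} → Subset m → Subset m → ℕ → ℕ
    chainSumFrom []      []      i = 1
    chainSumFrom (x ∷ X) (y ∷ Y) i = chainSum X Y (if y then firstBlock X else i)

  restSum : ∀ {m} → Subset m → Subset m → ℕ
  restSum []      []            = 1
  restSum (x ∷ X) (inside ∷ Y)  = chainSum X Y (firstBlock X)
  restSum (x ∷ X) (outside ∷ Y) = restSum X Y

  chainSum-factor : ∀ {m} (X Y : Subset m) c → chainSum X Y c ≡ descendingSum c (firstBlock Y) * restSum X Y
  chainSum-factor []      []            c = sym (*-identityʳ _)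
  chainSum-factor (x ∷ X) (inside ∷ Y)  c =
    trans (sumBelow-cong c (λ i _ → cong (_* chainSum X Y (firstBlock X)) (sym (*-identityʳ (q ^ i)))))
          (sumBelow-*ʳ c (λ i → q ^ i * 1) (chainSum X Y (firstBlock X)))
  chainSum-factor (x ∷ X) (outside ∷ Y) c =
    trans (sumBelow-cong c (λ i _ → trans (cong (q ^ i *_) (chainSum-factor X Y i)) (sym (*-assoc (q ^ i) _ _))))
          (sumBelow-*ʳ c (λ i → q ^ i * descendingSum i (firstBlock Y)) (restSum X Y))

  ∏! : List ℕ → ℕ
  ∏! bs = product (map [_]! bs)

  ∑C₂ : List ℕ → ℕ
  ∑C₂ bs = sum (map (_C 2) bs)

  mutual
    chainSum-closed : ∀ {m} (X Y : Subset m) → X ⊆ Y →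
      chainSum X Y (firstBlock X) * ∏! (blocks Y) ≡ q ^ ∑C₂ (blocks Y) * ∏! (blocks X)
    chainSum-closed X Y X⊆Y = begin
      chainSum X Y b * ∏! (blocks Y)
        ≡⟨ cong₂ (λ u v → u * ∏! v) (chainSum-factor X Y b) (blocks-split Y) ⟩
      descendingSum b r * restSum X Y * ([ r ]! * ∏! (tailBlocks Y))
        ≡⟨ swap (descendingSum b r) (restSum X Y) [ r ]! (∏! (tailBlocks Y)) ⟩
      descendingSum b r * [ r ]! * (restSum X Y * ∏! (tailBlocks Y))
        ≡⟨ cong (descendingSum b r * [ r ]! *_) (restSum-closed X Y X⊆Y) ⟩
      descendingSum b r * [ r ]! * (q ^ ∑C₂ (tailBlocks Y) * ([ b ∸ r ]! * ∏! (tailBlocks X)))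
        ≡⟨ reassoc (descendingSum b r) [ r ]! (q ^ ∑C₂ (tailBlocks Y)) [ b ∸ r ]! (∏! (tailBlocks X)) ⟩
      descendingSum b r * [ r ]! * [ b ∸ r ]! * q ^ ∑C₂ (tailBlocks Y) * ∏! (tailBlocks X)
        ≡⟨ cong (λ u → u * q ^ ∑C₂ (tailBlocks Y) * ∏! (tailBlocks X))
                (descendingSum-qbinomial′ (firstBlock-⊆ X⊆Y)) ⟩
      q ^ (r C 2) * [ b ]! * q ^ ∑C₂ (tailBlocks Y) * ∏! (tailBlocks X)
        ≡⟨ regroup (q ^ (r C 2)) [ b ]! (q ^ ∑C₂ (tailBlocks Y)) (∏! (tailBlocks X)) ⟩
      q ^ (r C 2) * q ^ ∑C₂ (tailBlocks Y) * ([ b ]! * ∏! (tailBlocks X))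
        ≡⟨ cong₂ _*_ (^-distribˡ-+-* q (r C 2) (∑C₂ (tailBlocks Y))) (cong ∏! (blocks-split X)) ⟨
      q ^ ∑C₂ (r ∷ tailBlocks Y) * ∏! (blocks X)
        ≡⟨ cong (λ v → q ^ ∑C₂ v * ∏! (blocks X)) (blocks-split Y) ⟨
      q ^ ∑C₂ (blocks Y) * ∏! (blocks X)
        ∎
      where
      b = firstBlock X
      r = firstBlock Y
      swap : ∀ d s f p → d * s * (f * p) ≡ d * f * (s * p)
      swap = solve-∀
      reassoc : ∀ d f z g p → d * f * (z * (g * p)) ≡ d * f * g * z * p
      reassoc = solve-∀
      regroup : ∀ a f z p → a * f * z * p ≡ a * z * (f * p)
      regroup = solve-∀

    restSum-closed : ∀ {m} (X Y : Subset m) → X ⊆ Y →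
      restSum X Y * ∏! (tailBlocks Y) ≡ q ^ ∑C₂ (tailBlocks Y) * ([ firstBlock X ∸ firstBlock Y ]! * ∏! (tailBlocks X))
    restSum-closed []            []            _   = refl
    restSum-closed (inside ∷ X)  (inside ∷ Y)  X⊆Y =
      trans (chainSum-closed X Y (drop-∷-⊆ X⊆Y)) (cong (q ^ ∑C₂ (blocks Y) *_) (sym (*-identityˡ _)))
    restSum-closed (outside ∷ X) (inside ∷ Y)  X⊆Y =
      trans (chainSum-closed X Y (drop-∷-⊆ X⊆Y)) (cong (λ v → q ^ ∑C₂ (blocks Y) * ∏! v) (blocks-split X))
    restSum-closed (inside ∷ X)  (outside ∷ Y) X⊆Y with () ← X⊆Y here
    restSum-closed (outside ∷ X) (outside ∷ Y) X⊆Y = restSum-closed X Y (drop-∷-⊆ X⊆Y)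

rank : (ℕ → Bool) → ℕ → ℕ
rank R B = sumBelow B (λ v → when (R v) 1)

remove : (ℕ → Bool) → ℕ → ℕ → Bool
remove R a v = R v ∧ not (does (v ≟ a))

remove-T : ∀ R {u v} → T (R u) → u ≢ v → T (remove R v u)
remove-T R {u} {v} Ru u≢v = Equivalence.from T-∧ (Ru , subst (T ∘ not) (sym (dec-false (u ≟ v) u≢v)) tt)

remove-⊆ : ∀ R {u v} → T (remove R v u) → T (R u)
remove-⊆ R = proj₁ ∘ Equivalence.to T-∧

remove-self : ∀ R {v} → ¬ T (remove R v v)
remove-self R {v} = subst (T ∘ not) (dec-true (v ≟ v) refl) ∘ proj₂ ∘ Equivalence.to T-∧

rank-mono : ∀ R {a b} → a ≤ b → rank R a ≤ rank R b
rank-mono R a≤b = go (≤⇒≤′ a≤b)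
  where
  go : ∀ {a b} → a ≤′ b → rank R a ≤ rank R b
  go (≤′-reflexive refl) = ≤-refl
  go (≤′-step a≤′b)      = ≤-trans (go a≤′b) (m≤m+n _ _)

rank-remove : ∀ R {v} → T (R v) → ∀ B → rank R B ≡ rank (remove R v) B + when (does (v <? B)) 1
rank-remove R {v} Rv zero    = refl
rank-remove R {v} Rv (suc B) with B ≟ v | rank-remove R Rv B
... | yes refl | IH with R B
...   | true  = begin
  rank R B + 1                              ≡⟨ cong (_+ 1) IH ⟩
  rank (remove R B) B + when (does (B <? B)) 1 + 1
    ≡⟨ cong (λ b → rank (remove R B) B + when b 1 + 1) (dec-false (B <? B) (<-irrefl refl)) ⟩
  rank (remove R B) B + 0 + 1
    ≡⟨ cong₂ (λ b c → rank (remove R B) B + when (not b) 1 + when c 1)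
             (dec-true (B ≟ B) refl) (dec-true (B <? suc B) (n<1+n B)) ⟨
  rank (remove R B) B + when (not (does (B ≟ B))) 1 + when (does (B <? suc B)) 1 ∎
rank-remove R {v} () (suc B) | yes refl | _ | false
rank-remove R {v} Rv (suc B) | no B≢v | IH = begin
  rank R B + when (R B) 1                                   ≡⟨ cong (_+ when (R B) 1) IH ⟩
  rank (remove R v) B + when (does (v <? B)) 1 + when (R B) 1 ≡⟨ xy∙z≈xz∙y (rank (remove R v) B) _ _ ⟩
  rank (remove R v) B + when (R B) 1 + when (does (v <? B)) 1
    ≡⟨ cong₂ (λ b c → rank (remove R v) B + when b 1 + when c 1)
             (trans (sym (∧-identityʳ (R B))) (cong (λ b → R B ∧ not b) (sym (dec-false (B ≟ v) B≢v))))
             (does-⇔ (mk⇔ m<n⇒m<1+n (λ v<1+B → ≤∧≢⇒< (s≤s⁻¹ v<1+B) (B≢v ∘ sym))) (v <? B) (v <? suc B)) ⟩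
  rank (remove R v) B + when (R B ∧ not (does (B ≟ v))) 1 + when (does (v <? suc B)) 1 ∎

rank-remove-self : ∀ R {v} → T (R v) → rank (remove R v) v ≡ rank R v
rank-remove-self R {v} Rv = sym (begin
  rank R v                                         ≡⟨ rank-remove R Rv v ⟩
  rank (remove R v) v + when (does (v <? v)) 1
    ≡⟨ cong (λ b → rank (remove R v) v + when b 1) (dec-false (v <? v) (<-irrefl refl)) ⟩
  rank (remove R v) v + 0                          ≡⟨ +-identityʳ _ ⟩
  rank (remove R v) v                              ∎)

rank-remove-< : ∀ R {v B} → T (R v) → v < B → rank R B ≡ suc (rank (remove R v) B)
rank-remove-< R {v} {B} Rv v<B = begin
  rank R B                                     ≡⟨ rank-remove R Rv B ⟩
  rank (remove R v) B + when (does (v <? B)) 1 ≡⟨ cong (λ b → rank (remove R v) B + when b 1) (dec-true (v <? B) v<B) ⟩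
  rank (remove R v) B + 1                      ≡⟨ +-comm _ 1 ⟩
  suc (rank (remove R v) B)                    ∎

rank-full : ∀ R a d → (∀ u → a ≤ u → u < a + d → T (R u)) → rank R (a + d) ≡ rank R a + d
rank-full R a zero    _    = trans (cong (rank R) (+-identityʳ a)) (sym (+-identityʳ _))
rank-full R a (suc d) full = begin
  rank R (a + suc d)                 ≡⟨ cong (rank R) (+-suc a d) ⟩
  rank R (a + d) + when (R (a + d)) 1 ≡⟨ cong₂ _+_ IH (when-T 1 (full (a + d) (m≤m+n a d) (+-monoʳ-< a (n<1+n d)))) ⟩
  rank R a + d + 1                   ≡⟨ +-assoc (rank R a) d 1 ⟩
  rank R a + (d + 1)                 ≡⟨ cong (rank R a +_) (+-comm d 1) ⟩
  rank R a + suc d                   ∎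
  where
  IH = rank-full R a d (λ u a≤u u<a+d → full u a≤u (<-trans u<a+d (+-monoʳ-< a (n<1+n d))))

rank-const-true : ∀ x → rank (const true) x ≡ x
rank-const-true zero    = refl
rank-const-true (suc x) = trans (cong (_+ 1) (rank-const-true x)) (+-comm x 1)

rank-sum : ∀ R B (h : ℕ → ℕ) → sumBelow B (λ v → when (R v) (h (rank R v))) ≡ sumBelow (rank R B) h
rank-sum R zero    h = refl
rank-sum R (suc B) h with R B
... | true  = trans (cong (_+ h (rank R B)) (rank-sum R B h)) (cong (λ c → sumBelow c h) (sym (+-comm (rank R B) 1)))
... | false = trans (cong (_+ 0) (rank-sum R B h))
                    (trans (+-identityʳ _) (cong (λ c → sumBelow c h) (sym (+-identityʳ (rank R B)))))

sumBelow-rank-reindex : ∀ R {B N} (h : ℕ → ℕ) → B ≤ N →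
  sumBelow N (λ v → when (R v ∧ does (v <? B)) (h (rank R v))) ≡ sumBelow (rank R B) h
sumBelow-rank-reindex R {B} {N} h B≤N = begin
  sumBelow N (λ v → when (R v ∧ does (v <? B)) (h (rank R v)))
    ≡⟨ sumBelow-cong N (λ v _ → when-∧ (R v) (does (v <? B)) (h (rank R v))) ⟩
  sumBelow N (λ v → when (does (v <? B)) (when (R v) (h (rank R v))))
    ≡⟨ sumBelow-restrict (λ v → when (R v) (h (rank R v))) B≤N ⟩
  sumBelow B (λ v → when (R v) (h (rank R v)))
    ≡⟨ rank-sum R B h ⟩
  sumBelow (rank R B) h
    ∎

InRange : ℕ → ℕ → ℕ → Set
InRange lo hi x = lo ≤ x × x < hi

injective-inRange⇒≤ : ∀ {a lo hi} (g : Fin a → ℕ) → (∀ i j → g i ≡ g j → i ≡ j) →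
  (∀ i → InRange lo hi (g i)) → a ≤ hi ∸ lo
injective-inRange⇒≤ {lo = lo} g g-inj g-inRange = injective⇒≤ f-inj
  where
  shifted< : ∀ i → g i ∸ lo < _
  shifted< i = ∸-monoˡ-< (proj₂ (g-inRange i)) (proj₁ (g-inRange i))
  f-inj : ∀ {i j} → fromℕ< (shifted< i) ≡ fromℕ< (shifted< j) → i ≡ j
  f-inj {i} {j} eq = g-inj i j (∸-cancelʳ-≡ (proj₁ (g-inRange i)) (proj₁ (g-inRange j))
    (trans (sym (toℕ-fromℕ< (shifted< i))) (trans (cong toℕ eq) (toℕ-fromℕ< (shifted< j)))))

module Permutation {n} (w : Vec (Fin n) n) (perm : IsPerm w) where

  value : Fin n → ℕ
  value p = toℕ (lookup w p)

  value-injective : ∀ p r → value p ≡ value r → p ≡ r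
  value-injective p r = perm p r ∘ toℕ-injective

  interval-preimage : ∀ {lo hi} → hi ≤ n → (∀ r → InRange lo hi (toℕ r) → InRange lo hi (value r)) →
    ∀ p → InRange lo hi (value p) → InRange lo hi (toℕ p)
  interval-preimage {lo} {hi} hi≤n into p vp∈@(lo≤vp , vp<hi) =
    -- otherwise p and the positions of [lo, hi) carry hi ∸ lo + 1 distinct values in [lo, hi)
    decidable-stable (lo ≤? toℕ p ×-dec toℕ p <? hi)
      (λ p∉ → 1+n≰n (injective-inRange⇒≤ g (g-injective p∉) g-inRange))
    where
    lo+s≡hi : lo + (hi ∸ lo) ≡ hi
    lo+s≡hi = m+[n∸m]≡n (≤-trans lo≤vp (<⇒≤ vp<hi))
    pos<hi : ∀ (i : Fin (hi ∸ lo)) → lo + toℕ i < hi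
    pos<hi i = subst (lo + toℕ i <_) lo+s≡hi (+-monoʳ-< lo (toℕ<n i))
    pos : Fin (hi ∸ lo) → Fin n
    pos i = fromℕ< (<-≤-trans (pos<hi i) hi≤n)
    toℕ-pos : ∀ i → toℕ (pos i) ≡ lo + toℕ i
    toℕ-pos i = toℕ-fromℕ< (<-≤-trans (pos<hi i) hi≤n)
    pos∈ : ∀ i → InRange lo hi (toℕ (pos i))
    pos∈ i rewrite toℕ-pos i = m≤m+n lo (toℕ i) , pos<hi i
    g : Fin (suc (hi ∸ lo)) → ℕ
    g fzero    = value p
    g (fsuc i) = value (pos i)
    g-inRange : ∀ i → InRange lo hi (g i)
    g-inRange fzero    = vp∈
    g-inRange (fsuc i) = into (pos i) (pos∈ i)
    g-injective : ¬ InRange lo hi (toℕ p) → ∀ i j → g i ≡ g j → i ≡ j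
    g-injective p∉ fzero    fzero    _  = refl
    g-injective p∉ fzero    (fsuc j) eq =
      contradiction (subst (InRange lo hi ∘ toℕ) (sym (value-injective _ _ eq)) (pos∈ j)) p∉
    g-injective p∉ (fsuc i) fzero    eq =
      contradiction (subst (InRange lo hi ∘ toℕ) (value-injective _ _ eq) (pos∈ i)) p∉
    g-injective p∉ (fsuc i) (fsuc j) eq = cong fsuc (toℕ-injective (+-cancelˡ-≡ lo _ _
      (trans (sym (toℕ-pos i)) (trans (cong toℕ (value-injective _ _ eq)) (toℕ-pos j)))))

  PrefixClosed : ℕ → Set
  PrefixClosed J = ∀ p → toℕ p ≤ J → value p ≤ J

  -- Separated (toℕ j) is InC w j.
  Separated : ℕ → Set
  Separated J = ∀ p r → toℕ p ≤ J → J < toℕ r → value p < value r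

  prefixClosed⇒separated : ∀ {J} → J < n → PrefixClosed J → Separated J
  prefixClosed⇒separated {J} J<n closed p r p≤J J<r = ≤-<-trans (closed p p≤J) (≰⇒> vr≰J)
    where
    vr≰J : ¬ value r ≤ J
    vr≰J vr≤J = <⇒≱ J<r (s≤s⁻¹ (proj₂ (interval-preimage J<n
      (λ r′ (_ , r′<1+J) → z≤n , s≤s (closed r′ (s≤s⁻¹ r′<1+J))) r (z≤n , s≤s vr≤J))))

  separated⇒prefixClosed : ∀ {J} → Separated J → PrefixClosed J
  separated⇒prefixClosed {J} sep p p≤J = decidable-stable (value p ≤? J) λ vp≰J →
    ≤⇒≯ p≤J (proj₁ (interval-preimage ≤-refl
      (λ r (J<r , _) → <-trans (≰⇒> vp≰J) (sep p r p≤J J<r) , toℕ<n (lookup w r))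
      p (≰⇒> vp≰J , toℕ<n (lookup w p))))

-- Defs.inv at every word length, so that inv w is inversions w by definition.
inversions : ∀ {N m} → Vec (Fin N) m → ℕ
inversions {m = m} w = sum (map (λ i → sum (map (λ j →
  if ⌊ i <ᶠ? j ⌋ then (if ⌊ lookup w j <ᶠ? lookup w i ⌋ then 1 else 0) else 0) (allFin m))) (allFin m))

count-∷ : ∀ {N m} (a b : Fin N) (w : Vec (Fin N) m) →
  count (_<ᶠ? a) (b ∷ w) ≡ (if ⌊ b <ᶠ? a ⌋ then 1 else 0) + count (_<ᶠ? a) w
count-∷ a b w = go (b <ᶠ? a)
  where
  go : ∀ {A : Set} (d : Dec A) →
    (if does d then suc else (λ c → c)) (count (_<ᶠ? a) w) ≡ (if ⌊ d ⌋ then 1 else 0) + count (_<ᶠ? a) w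
  go (yes _) = refl
  go (no _)  = refl

count≡sum : ∀ {N m} (a : Fin N) (w : Vec (Fin N) m) →
  count (_<ᶠ? a) w ≡ sum (map (λ j → if ⌊ lookup w j <ᶠ? a ⌋ then 1 else 0) (allFin m))
count≡sum a []          = refl
count≡sum a (_∷_ {m} b w) = begin
  count (_<ᶠ? a) (b ∷ w)                                   ≡⟨ count-∷ a b w ⟩
  (if ⌊ b <ᶠ? a ⌋ then 1 else 0) + count (_<ᶠ? a) w        ≡⟨ cong (_ +_) (count≡sum a w) ⟩
  (if ⌊ b <ᶠ? a ⌋ then 1 else 0) + sum (map (λ j → if ⌊ lookup w j <ᶠ? a ⌋ then 1 else 0) (allFin m))
    ≡⟨ sum-allFin-suc m (λ j → if ⌊ lookup (b ∷ w) j <ᶠ? a ⌋ then 1 else 0) ⟨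
  sum (map (λ j → if ⌊ lookup (b ∷ w) j <ᶠ? a ⌋ then 1 else 0) (allFin (suc m))) ∎

inversions-∷ : ∀ {N m} (a : Fin N) (w : Vec (Fin N) m) → inversions (a ∷ w) ≡ count (_<ᶠ? a) w + inversions w
inversions-∷ {m = m} a w = begin
  inversions (a ∷ w)
    ≡⟨ sum-allFin-suc m (λ i → sum (map (E i) (allFin (suc m)))) ⟩
  sum (map (E fzero) (allFin (suc m))) + sum (map (λ i → sum (map (E (fsuc i)) (allFin (suc m)))) (allFin m))
    ≡⟨ cong₂ _+_ (sum-allFin-suc m (E fzero)) (cong sum (map-cong (λ i → sum-allFin-suc m (E (fsuc i))) (allFin m))) ⟩
  sum (map (E fzero ∘ fsuc) (allFin m)) + sum (map (λ i → sum (map (E (fsuc i) ∘ fsuc) (allFin m))) (allFin m))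
    ≡⟨ cong₂ _+_ (count≡sum a w) (cong sum (map-cong (λ i → cong sum (map-cong (λ j →
         cong (λ b → if b then (if ⌊ lookup w j <ᶠ? lookup w i ⌋ then 1 else 0) else 0) (shift-< i j)) (allFin m))) (allFin m))) ⟨
  count (_<ᶠ? a) w + inversions w ∎
  where
  E : Fin (suc m) → Fin (suc m) → ℕ
  E i j = if ⌊ i <ᶠ? j ⌋ then (if ⌊ lookup (a ∷ w) j <ᶠ? lookup (a ∷ w) i ⌋ then 1 else 0) else 0
  shift-< : ∀ (i j : Fin m) → ⌊ i <ᶠ? j ⌋ ≡ ⌊ fsuc i <ᶠ? fsuc j ⌋
  shift-< i j = trans (isYes≗does (i <ᶠ? j))
    (trans (does-⇔ (mk⇔ s≤s s≤s⁻¹) (i <ᶠ? j) (fsuc i <ᶠ? fsuc j)) (sym (isYes≗does (fsuc i <ᶠ? fsuc j))))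

DrawnFrom : ∀ {N m} → (ℕ → Bool) → Vec (Fin N) m → Set
DrawnFrom R []      = ⊤
DrawnFrom R (a ∷ w) = T (R (toℕ a)) × DrawnFrom (remove R (toℕ a)) w

drawnFrom-count : ∀ {N m R} {w : Vec (Fin N) m} → DrawnFrom R w → rank R N ≡ m →
  ∀ (a : Fin N) → count (_<ᶠ? a) w ≡ rank R (toℕ a)
drawnFrom-count {R = R} {w = []}    _            size a =
  sym (n≤0⇒n≡0 (subst (rank R (toℕ a) ≤_) size (rank-mono R (<⇒≤ (toℕ<n a)))))
drawnFrom-count {R = R} {w = b ∷ w} (Rb , drawn) size a = begin
  count (_<ᶠ? a) (b ∷ w)                                          ≡⟨ count-∷ a b w ⟩
  (if ⌊ b <ᶠ? a ⌋ then 1 else 0) + count (_<ᶠ? a) w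
    ≡⟨ cong₂ (λ c d → (if c then 1 else 0) + d) (isYes≗does (b <ᶠ? a))
             (drawnFrom-count drawn (suc-injective (trans (sym (rank-remove-< R Rb (toℕ<n b))) size)) a) ⟩
  when (does (toℕ b <? toℕ a)) 1 + rank (remove R (toℕ b)) (toℕ a) ≡⟨ +-comm (when (does (toℕ b <? toℕ a)) 1) _ ⟩
  rank (remove R (toℕ b)) (toℕ a) + when (does (toℕ b <? toℕ a)) 1 ≡⟨ rank-remove R Rb (toℕ a) ⟨
  rank R (toℕ a)                                                  ∎

drawnFrom-member : ∀ {N m R} (w : Vec (Fin N) m) → DrawnFrom R w → ∀ i → T (R (toℕ (lookup w i)))
drawnFrom-member (a ∷ w) (Ra , drawn) fzero    = Ra
drawnFrom-member {R = R} (a ∷ w) (Ra , drawn) (fsuc i) = remove-⊆ R (drawnFrom-member w drawn i)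

drawnFrom-injective : ∀ {N m R} (w : Vec (Fin N) m) → DrawnFrom R w → ∀ i j → lookup w i ≡ lookup w j → i ≡ j
drawnFrom-injective (a ∷ w) drawn        fzero    fzero    _  = refl
drawnFrom-injective {R = R} (a ∷ w) (_ , drawn) fzero (fsuc j) eq =
  contradiction (subst (λ b → T (remove R (toℕ a) (toℕ b))) (sym eq) (drawnFrom-member w drawn j)) (remove-self R)
drawnFrom-injective {R = R} (a ∷ w) (_ , drawn) (fsuc i) fzero eq =
  contradiction (subst (λ b → T (remove R (toℕ a) (toℕ b))) eq (drawnFrom-member w drawn i)) (remove-self R)
drawnFrom-injective (a ∷ w) (_ , drawn)  (fsuc i) (fsuc j) eq = cong fsuc (drawnFrom-injective w drawn i j eq)

injective⇒drawnFrom : ∀ {N m R} (w : Vec (Fin N) m) → (∀ i → T (R (toℕ (lookup w i)))) →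
  (∀ i j → lookup w i ≡ lookup w j → i ≡ j) → DrawnFrom R w
injective⇒drawnFrom []      _      _   = tt
injective⇒drawnFrom {R = R} (a ∷ w) member inj = member fzero , injective⇒drawnFrom w
  (λ i → remove-T R (member (fsuc i)) (λ eq → contradiction (inj (fsuc i) fzero (toℕ-injective eq)) λ ()))
  (λ i j eq → fsuc-injective (inj (fsuc i) (fsuc j) eq))

InBlocks : ∀ {N m} → ℕ → Subset m → Vec (Fin N) (suc m) → Set
InBlocks t []      (a ∷ []) = toℕ a < t + firstBlock []
InBlocks t (x ∷ X) (a ∷ w)  = toℕ a < t + firstBlock (x ∷ X) × InBlocks (suc t) X w

BlockBounded : ∀ {N m} → ℕ → Subset m → Vec (Fin N) (suc m) → Set
BlockBounded t X w = ∀ j → j ∈ X → ∀ p → toℕ p ≤ toℕ j → toℕ (lookup w p) ≤ t + toℕ j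

inBlocks⇒blockBounded : ∀ {N m t} (X : Subset m) (w : Vec (Fin N) (suc m)) → InBlocks t X w → BlockBounded t X w
inBlocks⇒blockBounded {t = t} (x ∷ X) (a ∷ w) (a< , _) j j∈ fzero _ =
  s≤s⁻¹ (subst (toℕ a <_) (+-suc t (toℕ j)) (<-≤-trans a< (+-monoʳ-≤ t (firstBlock-∈ j∈))))
inBlocks⇒blockBounded {t = t} (x ∷ X) (a ∷ w) (_ , inBlocks) (fsuc j) (there j∈) (fsuc p) (s≤s p≤j) =
  subst (toℕ (lookup w p) ≤_) (sym (+-suc t (toℕ j))) (inBlocks⇒blockBounded X w inBlocks j j∈ p p≤j)

blockBounded⇒inBlocks : ∀ {N m t} (X : Subset m) (w : Vec (Fin N) (suc m)) →
  (∀ p → toℕ (lookup w p) < t + suc m) → BlockBounded t X w → InBlocks t X w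
blockBounded⇒inBlocks []      (a ∷ []) below _       = below fzero
blockBounded⇒inBlocks {m = suc m} {t} (x ∷ X) (a ∷ w) below bounded =
  below-firstBlock (x ∷ X) (λ j j∈ → bounded j j∈ fzero z≤n) (below fzero) ,
  blockBounded⇒inBlocks X w
    (λ p → subst (toℕ (lookup w p) <_) (+-suc t (suc m)) (below (fsuc p)))
    (λ j j∈ p p≤j → subst (toℕ (lookup w p) ≤_) (+-suc t (toℕ j)) (bounded (fsuc j) (there j∈) (fsuc p) (s≤s p≤j)))

RespectsCap : Maybe ℕ → ℕ → Set
RespectsCap nothing  v = ⊤
RespectsCap (just b) v = v < b

respectsCap? : ∀ cap v → Dec (RespectsCap cap v)
respectsCap? nothing  v = yes tt
respectsCap? (just b) v = v <? b

nextCap : Bool → ℕ → Maybe ℕ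
nextCap descent v = if descent then just v else nothing

Descents : ∀ {N m} → Maybe ℕ → Subset m → Vec (Fin N) (suc m) → Set
Descents cap []      (a ∷ []) = RespectsCap cap (toℕ a)
Descents cap (d ∷ D) (a ∷ w)  = RespectsCap cap (toℕ a) × Descents (nextCap d (toℕ a)) D w

-- InDes w j, for words over any alphabet.
Descent : ∀ {N m} → Vec (Fin N) (suc m) → Fin m → Set
Descent w j = toℕ (lookup w (fsuc j)) < toℕ (lookup w (inject₁ j))

descents-head : ∀ {N m cap} (D : Subset m) (w : Vec (Fin N) (suc m)) →
  Descents cap D w → RespectsCap cap (toℕ (lookup w fzero))
descents-head []      (a ∷ []) r       = r
descents-head (d ∷ D) (a ∷ w)  (r , _) = r

descents⇒descent : ∀ {N m cap} (D : Subset m) (w : Vec (Fin N) (suc m)) → Descents cap D w → ∀ j → j ∈ D → Descent w j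
descents⇒descent (inside ∷ D) (a ∷ w) (_ , ds) fzero    here       = descents-head D w ds
descents⇒descent (d ∷ D)      (a ∷ w) (_ , ds) (fsuc j) (there j∈) = descents⇒descent D w ds j j∈

descent⇒descents : ∀ {N m cap} (D : Subset m) (w : Vec (Fin N) (suc m)) →
  RespectsCap cap (toℕ (lookup w fzero)) → (∀ j → j ∈ D → Descent w j) → Descents cap D w
descent⇒descents []            (a ∷ [])    r _   = r
descent⇒descents (inside ∷ D)  (a ∷ b ∷ w) r des =
  r , descent⇒descents D (b ∷ w) (des fzero here) (λ j j∈ → des (fsuc j) (there j∈))
descent⇒descents (outside ∷ D) (a ∷ b ∷ w) r des =
  r , descent⇒descents D (b ∷ w) tt (λ j j∈ → des (fsuc j) (there j∈))

-- A state at position t: R is the set of unused values, X and D are S̄ and T restricted to the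
-- cuts t, t + 1, …, and cap is the previous letter when the cut before t lies in T.
module WordSum (q n : ℕ) where

  open QCalculus q

  Allowed : ∀ {m} → ℕ → (ℕ → Bool) → Maybe ℕ → Subset m → ℕ → Set
  Allowed t R cap X v = T (R v) × v < t + firstBlock X × RespectsCap cap v

  allowed? : ∀ {m} t R cap (X : Subset m) v → Dec (Allowed t R cap X v)
  allowed? t R cap X v = T? (R v) ×-dec (v <? t + firstBlock X) ×-dec respectsCap? cap v

  mutual
    weight : ∀ {m} → ℕ → (ℕ → Bool) → Maybe ℕ → Subset m → Subset m → Vec (Fin n) (suc m) → ℕ
    weight t R cap X D (a ∷ w) =
      when (does (allowed? t R cap X (toℕ a))) (q ^ rank R (toℕ a) * weightAfter t R X D (toℕ a) w)

    weightAfter : ∀ {m} → ℕ → (ℕ → Bool) → Subset m → Subset m → ℕ → Vec (Fin n) m → ℕ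
    weightAfter t R []      []      v [] = 1
    weightAfter t R (x ∷ X) (d ∷ D) v w  = weight (suc t) (remove R v) (nextCap d v) X D w

  wordSum : ∀ {m} → ℕ → (ℕ → Bool) → Maybe ℕ → Subset m → Subset m → ℕ
  wordSum {m} t R cap X D = sum (map (weight t R cap X D) (allWords n (suc m)))

  bound : ∀ {m} → ℕ → Maybe ℕ → Subset m → ℕ
  bound t cap X = fromMaybe (t + firstBlock X) cap

  bound≤blockEnd : ∀ {m t cap} {X : Subset m} → AllMaybe (_≤ t + firstBlock X) cap → bound t cap X ≤ t + firstBlock X
  bound≤blockEnd (just b≤) = b≤
  bound≤blockEnd nothing   = ≤-refl

  allowed⇔ : ∀ {m t R cap} {X : Subset m} v → AllMaybe (_≤ t + firstBlock X) cap →
    Allowed t R cap X v ⇔ (T (R v) × v < bound t cap X)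
  allowed⇔ v (just b≤) = mk⇔ (λ (Rv , _ , v<b) → Rv , v<b) (λ (Rv , v<b) → Rv , <-≤-trans v<b b≤ , v<b)
  allowed⇔ v nothing   = mk⇔ (λ (Rv , v< , _) → Rv , v<) (λ (Rv , v<) → Rv , v< , tt)

  record Invariant {m} (t : ℕ) (R : ℕ → Bool) (cap : Maybe ℕ) (X : Subset m) : Set where
    field
      size      : rank R n ≡ suc m
      position  : t + suc m ≡ n
      unused-beyond-block : ∀ u → t + firstBlock X ≤ u → u < n → T (R u)
      cap-bound : AllMaybe (_≤ t + firstBlock X) cap

  module _ {m t R cap} {X : Subset m} (I : Invariant t R cap X) where
    open Invariant I

    blockEnd≤n : t + firstBlock X ≤ n
    blockEnd≤n = subst (t + firstBlock X ≤_) position (+-monoʳ-≤ t (firstBlock≤1+m X))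

    block-rank : rank R (t + firstBlock X) ≡ firstBlock X
    block-rank = +-cancelʳ-≡ (suc m ∸ firstBlock X) _ _ (begin
      rank R e + (suc m ∸ firstBlock X) ≡⟨ cong (rank R e +_) ([m+n]∸[m+o]≡n∸o t (suc m) (firstBlock X)) ⟨
      rank R e + (t + suc m ∸ e)       ≡⟨ cong (λ k → rank R e + (k ∸ e)) position ⟩
      rank R e + (n ∸ e)
        ≡⟨ rank-full R e (n ∸ e) (λ u e≤u u<e+[n∸e] →
             unused-beyond-block u e≤u (subst (u <_) (m+[n∸m]≡n blockEnd≤n) u<e+[n∸e])) ⟨
      rank R (e + (n ∸ e))             ≡⟨ cong (rank R) (m+[n∸m]≡n blockEnd≤n) ⟩
      rank R n                         ≡⟨ size ⟩
      suc m                            ≡⟨ m+[n∸m]≡n (firstBlock≤1+m X) ⟨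
      firstBlock X + (suc m ∸ firstBlock X) ∎)
      where e = t + firstBlock X

  wordSum-reduce : ∀ {m t R cap} {X D : Subset m} → Invariant t R cap X →
    (∀ v → Allowed t R cap X v → sum (map (weightAfter t R X D v) (allWords n m)) ≡ chainSumFrom X (∁ D) (rank R v)) →
    wordSum t R cap X D ≡ chainSum X (∁ D) (rank R (bound t cap X))
  wordSum-reduce {m} {t} {R} {cap} {X} {D} I after = begin
    sum (map (weight t R cap X D) (concatMap (λ a → map (a ∷_) ws) (allFin n)))
      ≡⟨ sum-map-concatMap (weight t R cap X D) (λ a → map (a ∷_) ws) (allFin n) ⟩
    sum (map (λ a → sum (map (weight t R cap X D) (map (a ∷_) ws))) (allFin n))
      ≡⟨ cong sum (map-cong firstLetter (allFin n)) ⟩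
    sum (map (g ∘ toℕ) (allFin n))
      ≡⟨ sum-map-allFin n g ⟩
    sumBelow n g
      ≡⟨ sumBelow-cong n (λ v _ → cong (λ b → when b (h (rank R v)))
           (does-⇔ (allowed⇔ {t = t} {R} {X = X} v cap-bound)
                   (allowed? t R cap X v) (T? (R v) ×-dec (v <? bound t cap X)))) ⟩
    sumBelow n (λ v → when (R v ∧ does (v <? bound t cap X)) (h (rank R v)))
      ≡⟨ sumBelow-rank-reindex R h (≤-trans (bound≤blockEnd {t = t} {X = X} cap-bound) (blockEnd≤n I)) ⟩
    chainSum X (∁ D) (rank R (bound t cap X))
      ∎
    where
    open Invariant I
    ws = allWords n m
    h : ℕ → ℕ
    h i = q ^ i * chainSumFrom X (∁ D) i
    g : ℕ → ℕ
    g v = when (does (allowed? t R cap X v)) (h (rank R v))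
    firstLetter : ∀ a → sum (map (weight t R cap X D) (map (a ∷_) ws)) ≡ g (toℕ a)
    firstLetter a = begin
      sum (map (weight t R cap X D) (map (a ∷_) ws))
        ≡⟨ cong sum (map-∘ ws) ⟨
      sum (map (λ w → when b (q ^ r * weightAfter t R X D v w)) ws)
        ≡⟨ sum-map-when b (λ w → q ^ r * weightAfter t R X D v w) ws ⟩
      when b (sum (map (λ w → q ^ r * weightAfter t R X D v w) ws))
        ≡⟨ cong (when b) (sum-map-*ˡ (q ^ r) (weightAfter t R X D v) ws) ⟩
      when b (q ^ r * sum (map (weightAfter t R X D v) ws))
        ≡⟨ when-dec-cong (allowed? t R cap X v) (cong (q ^ r *_) ∘ after v) ⟩
      g v
        ∎
      where
      v = toℕ a
      r = rank R v
      b = does (allowed? t R cap X v)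

  invariant-step : ∀ {m t R cap x v} d {X : Subset m} → Invariant t R cap (x ∷ X) → Allowed t R cap (x ∷ X) v →
    Invariant (suc t) (remove R v) (nextCap d v) X
  invariant-step {m} {t} {R} {cap} {x} {v} d {X} I (Rv , v<e , _) = record
    { size      = suc-injective (trans (sym (rank-remove-< R Rv (<-≤-trans v<e (blockEnd≤n I)))) size)
    ; position  = trans (sym (+-suc t (suc m))) position
    ; unused-beyond-block = λ u e′≤u u<n → remove-T R (unused-beyond-block u (≤-trans e≤e′ e′≤u) u<n)
                                   (λ u≡v → <-irrefl (sym u≡v) (<-≤-trans v<e (≤-trans e≤e′ e′≤u)))
    ; cap-bound = nextCap-bound d
    }
    where
    open Invariant I
    e≤e′ : t + firstBlock (x ∷ X) ≤ suc t + firstBlock X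
    e≤e′ = subst (t + firstBlock (x ∷ X) ≤_) (+-suc t (firstBlock X)) (+-monoʳ-≤ t (firstBlock-∷ x X))
    nextCap-bound : ∀ d → AllMaybe (_≤ suc t + firstBlock X) (nextCap d v)
    nextCap-bound true  = just (<⇒≤ (<-≤-trans v<e e≤e′))
    nextCap-bound false = nothing

  wordSum-chainSum : ∀ {m t R cap} (X D : Subset m) → Invariant t R cap X →
    wordSum t R cap X D ≡ chainSum X (∁ D) (rank R (bound t cap X))
  wordSum-chainSum []      []      I = wordSum-reduce I (λ _ _ → refl)
  wordSum-chainSum {t = t} {R} (x ∷ X) (d ∷ D) I = wordSum-reduce I (λ v ok →
    trans (wordSum-chainSum X D (invariant-step d I ok)) (cong (chainSum X (∁ D)) (rank-after v ok d)))
    where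
    rank-after : ∀ v → Allowed t R _ (x ∷ X) v → ∀ d →
      rank (remove R v) (bound (suc t) (nextCap d v) X) ≡ (if not d then firstBlock X else rank R v)
    rank-after v ok true  = rank-remove-self R (proj₁ ok)
    rank-after v ok false = block-rank (invariant-step false I ok)

  Valid : ∀ {m} → ℕ → (ℕ → Bool) → Maybe ℕ → Subset m → Subset m → Vec (Fin n) (suc m) → Set
  Valid t R cap X D w = DrawnFrom R w × InBlocks t X w × Descents cap D w

  weight-∷ : ∀ {m} t R cap (X D : Subset m) a w → Allowed t R cap X (toℕ a) →
    weight t R cap X D (a ∷ w) ≡ q ^ rank R (toℕ a) * weightAfter t R X D (toℕ a) w
  weight-∷ t R cap X D a w ok =
    cong (λ b → when b (q ^ rank R (toℕ a) * weightAfter t R X D (toℕ a) w)) (dec-true (allowed? t R cap X (toℕ a)) ok)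

  inversions-via-rank : ∀ {m R x} {a : Fin n} {w : Vec (Fin n) m} → DrawnFrom R (a ∷ w) → rank R n ≡ suc m →
    x ≡ q ^ inversions w → q ^ rank R (toℕ a) * x ≡ q ^ inversions (a ∷ w)
  inversions-via-rank {R = R} {x} {a} {w} (Ra , drawn) size x≡ = begin
    q ^ rank R (toℕ a) * x                        ≡⟨ cong₂ (λ r y → q ^ r * y) (sym below-a) x≡ ⟩
    q ^ count (_<ᶠ? a) w * q ^ inversions w       ≡⟨ ^-distribˡ-+-* q (count (_<ᶠ? a) w) (inversions w) ⟨
    q ^ (count (_<ᶠ? a) w + inversions w)         ≡⟨ cong (q ^_) (inversions-∷ a w) ⟨
    q ^ inversions (a ∷ w)                        ∎
    where
    below-a : count (_<ᶠ? a) w ≡ rank R (toℕ a)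
    below-a = trans (drawnFrom-count drawn (suc-injective (trans (sym (rank-remove-< R Ra (toℕ<n a))) size)) a)
                    (rank-remove-self R Ra)

  weight-valid : ∀ {m t R cap} (X D : Subset m) (w : Vec (Fin n) (suc m)) → rank R n ≡ suc m →
    Valid t R cap X D w → weight t R cap X D w ≡ q ^ inversions w
  weight-valid {t = t} {R} {cap} [] [] (a ∷ []) size (drawn@(Ra , _) , a< , r) =
    trans (weight-∷ t R cap [] [] a [] (Ra , a< , r)) (inversions-via-rank drawn size refl)
  weight-valid {t = t} {R} {cap} (x ∷ X) (d ∷ D) (a ∷ w) size
               (drawn@(Ra , drawnʷ) , (a< , inBlocks) , (r , descents)) =
    trans (weight-∷ t R cap (x ∷ X) (d ∷ D) a w (Ra , a< , r)) (inversions-via-rank drawn size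
      (weight-valid X D w (suc-injective (trans (sym (rank-remove-< R Ra (toℕ<n a))) size)) (drawnʷ , inBlocks , descents)))

  weight-invalid : ∀ {m t R cap} (X D : Subset m) (w : Vec (Fin n) (suc m)) →
    ¬ Valid t R cap X D w → weight t R cap X D w ≡ 0
  weight-invalid {t = t} {R} {cap} [] [] (a ∷ []) invalid =
    when-dec-zero (allowed? t R cap [] (toℕ a)) (λ (Ra , a< , r) → contradiction ((Ra , tt) , a< , r) invalid)
  weight-invalid {t = t} {R} {cap} (x ∷ X) (d ∷ D) (a ∷ w) invalid =
    when-dec-zero (allowed? t R cap (x ∷ X) (toℕ a)) (λ (Ra , a< , r) →
      trans (cong (q ^ rank R (toℕ a) *_) (weight-invalid X D w (λ (drawn , inBlocks , descents) →
              invalid ((Ra , drawn) , (a< , inBlocks) , (r , descents)))))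
            (*-zeroʳ (q ^ rank R (toℕ a))))

disjoint⇒⊆∁ : ∀ {m} {X Y : Subset m} → Empty (X ∩ Y) → X ⊆ ∁ Y
disjoint⇒⊆∁ X∩Y≡∅ x∈X = x∉p⇒x∈∁p (λ x∈Y → X∩Y≡∅ (_ , x∈p∩q⁺ (x∈X , x∈Y)))

admissible⇒disjoint : ∀ {k} (S T : Subset k) (w : Vec (Fin (suc k)) (suc k)) → Admissible S T w → Empty (∁ S ∩ T)
admissible⇒disjoint S T w (separated , descents) (j , j∈) with x∈p∩q⁻ (∁ S) T j∈
... | j∈∁S , j∈T =
  <-asym (separated j j∈∁S (inject₁ j) (fsuc j) (≤-reflexive (toℕ-inject₁ j)) (n<1+n (toℕ j))) (descents j j∈T)

module _ (k : ℕ) (S T : Subset k) (q : ℕ) where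

  open QCalculus q
  open WordSum q (suc k)

  valid⇒admissible : ∀ w → Valid 0 (const true) nothing (∁ S) T w → IsPerm w × Admissible S T w
  valid⇒admissible w (drawn , inBlocks , descents) =
    perm ,
    (λ j j∈ → prefixClosed⇒separated (m<n⇒m<1+n (toℕ<n j)) (inBlocks⇒blockBounded (∁ S) w inBlocks j j∈)) ,
    descents⇒descent T w descents
    where
    perm = drawnFrom-injective w drawn
    open Permutation w perm

  admissible⇒valid : ∀ w → IsPerm w → Admissible S T w → Valid 0 (const true) nothing (∁ S) T w
  admissible⇒valid w perm (separated , descents) =
    injective⇒drawnFrom w (λ _ → tt) perm ,
    blockBounded⇒inBlocks (∁ S) w (λ p → toℕ<n (lookup w p)) (λ j j∈ → separated⇒prefixClosed (separated j j∈)) ,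
    descent⇒descents T w tt descents
    where open Permutation w perm

  weight≡summand : ∀ w → weight 0 (const true) nothing (∁ S) T w ≡
    (if ⌊ isPerm? w ⌋ then (if ⌊ admissible? S T w ⌋ then q ^ inv w else 0) else 0)
  weight≡summand w with isPerm? w | admissible? S T w
  ... | yes perm | yes adm = weight-valid (∁ S) T w (rank-const-true (suc k)) (admissible⇒valid w perm adm)
  ... | yes perm | no ¬adm = weight-invalid (∁ S) T w (¬adm ∘ proj₂ ∘ valid⇒admissible w)
  ... | no ¬perm | _       = weight-invalid (∁ S) T w (¬perm ∘ proj₁ ∘ valid⇒admissible w)

  A≡wordSum : A k S T q ≡ wordSum 0 (const true) nothing (∁ S) T
  A≡wordSum = cong sum (map-cong (sym ∘ weight≡summand) (allWords (suc k) (suc k)))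

  A≡chainSum : A k S T q ≡ chainSum (∁ S) (∁ T) (firstBlock (∁ S))
  A≡chainSum = begin
    A k S T q                                                        ≡⟨ A≡wordSum ⟩
    wordSum 0 (const true) nothing (∁ S) T                           ≡⟨ wordSum-chainSum (∁ S) T initial ⟩
    chainSum (∁ S) (∁ T) (rank (const true) (firstBlock (∁ S)))
      ≡⟨ cong (chainSum (∁ S) (∁ T)) (rank-const-true (firstBlock (∁ S))) ⟩
    chainSum (∁ S) (∁ T) (firstBlock (∁ S))                          ∎
    where
    initial : Invariant 0 (const true) nothing (∁ S)
    initial = record
      { size = rank-const-true (suc k) ; position = refl ; unused-beyond-block = λ _ _ _ → tt ; cap-bound = nothing }

  A-closed-form : Empty (∁ S ∩ T) → A k S T q * η (∁ T) q ≡ q ^ z T * η (∁ S) q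
  A-closed-form disjoint =
    trans (cong (_* η (∁ T) q) A≡chainSum) (chainSum-closed (∁ S) (∁ T) (disjoint⇒⊆∁ disjoint))

  A-vanishes : ¬ Empty (∁ S ∩ T) → A k S T q ≡ 0
  A-vanishes meets = trans A≡wordSum (sum-map-zero _ (allWords (suc k) (suc k)) (λ w →
    weight-invalid (∁ S) T w (meets ∘ admissible⇒disjoint S T w ∘ proj₂ ∘ valid⇒admissible w)))

theorem2p2 : (k : ℕ) (S T : Subset k) →
    (Empty (∁ S ∩ T) → (q : ℕ) → A k S T q * η (∁ T) q ≡ q ^ z T * η (∁ S) q)
    × (¬ Empty (∁ S ∩ T) → (q : ℕ) → A k S T q ≡ 0)
theorem2p2 k S T = (λ disjoint q → A-closed-form k S T q disjoint) , (λ meets q → A-vanishes k S T q meets)
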